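{- For $n\geq 1$, $$T_n(x)=T_n^E(x^2)+xT_n^O(x^2),\qquad \overline{W}_n(x)=T_n^E(x)+T_n^O(x).$$
   Context: $\mathcal{S}_n$ is the symmetric group on $[n]$, $\pi=\pi(1)\cdots\pi(n)$, with the convention $\pi(0)=0$. An alternating run of a sequence is a maximal contiguous increasing or decreasing subsequence; ${\rm udrun}(\pi)$ (number of up-down runs) is the number of alternating runs of the sequence $0\,\pi(1)\pi(2)\cdots\pi(n)$. The left peak number is ${\rm lpk}(\pi)=\#\{i\in[n-1]:\pi(i-1)<\pi(i)>\pi(i+1)\}$ (with $\pi(0)=0$). Let $T_n(x)=\sum_{\pi\in\mathcal{S}_n}x^{{\rm udrun}(\pi)}$ and $\overline{W}_n(x)=\sum_{\pi\in\mathcal{S}_n}x^{{\rm lpk}(\pi)}$. Let $\mathcal{S}_n^+=\{\pi\in\mathcal{S}_n:\pi(n-1)>\pi(n)\}$, $\mathcal{S}_n^-=\{\pi\in\mathcal{S}_n:\pi(n-1)<\pi(n)\}$, $T_n^E(x)=\sum_{\pi\in\mathcal{S}_n^+}x^{{\rm lpk}(\pi)}$, $T_n^O(x)=\sum_{\pi\in\mathcal{S}_n^- }x^{{\rm lpk}(\pi)}$. -}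

module Defs where

open import Data.Nat using (ℕ; zero; suc; _+_; _*_; _^_; _<_; _<?_)
open import Data.Nat.Properties using (_≟_)
open import Data.List using (List; []; _∷_; map; concatMap; filter; length)
open import Data.Nat.ListAction using (sum)
open import Data.Bool using (Bool; true; false; _∧_; if_then_else_)
open import Relation.Nullary.Decidable using (⌊_⌋)
open import Data.List.Relation.Unary.Unique.DecPropositional _≟_ using (unique?)

range : ℕ → List ℕ
range zero = []
range (suc n) = range n Data.List.++ (suc n ∷ [])

words : ℕ → ℕ → List (List ℕ)
words n zero = [] ∷ []
words n (suc k) = concatMap (λ a → map (a ∷_) (words n k)) (range n)

-- S_n : permutations of [n] in one-line notation π(1)⋯π(n),
-- i.e. words of length n over [n] with no repeated letter.
Sn : ℕ → List (List ℕ)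
Sn n = filter unique? (words n n)

lt : ℕ → ℕ → Bool
lt a b = ⌊ a <? b ⌋

-- number of alternating runs of a sequence of distinct numbers:
-- (for length ≥ 2) one more than the number of interior positions where
-- the direction changes, i.e. interior peaks or valleys.
turns : List ℕ → ℕ
turns (a ∷ b ∷ c ∷ rest) =
  (if (lt a b ∧ lt c b) then 1 else if (lt b a ∧ lt b c) then 1 else 0)
  + turns (b ∷ c ∷ rest)
turns _ = 0

altruns : List ℕ → ℕ
altruns (a ∷ b ∷ rest) = suc (turns (a ∷ b ∷ rest))
altruns _ = 0

udrun : List ℕ → ℕ
udrun π = altruns (0 ∷ π)

peaks : List ℕ → ℕ
peaks (a ∷ b ∷ c ∷ rest) = (if (lt a b ∧ lt c b) then 1 else 0) + peaks (b ∷ c ∷ rest)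
peaks _ = 0

lpk : List ℕ → ℕ
lpk π = peaks (0 ∷ π)

-- π(n-1) > π(n), with convention π(0) = 0 (the last two entries of 0 π(1)⋯π(n))
lastDesc : List ℕ → Bool
lastDesc (a ∷ b ∷ []) = lt b a
lastDesc (a ∷ b ∷ c ∷ rest) = lastDesc (b ∷ c ∷ rest)
lastDesc _ = false

isPlus : List ℕ → Bool
isPlus π = lastDesc (0 ∷ π)

isMinus : List ℕ → Bool
isMinus π = if isPlus π then false else true

bfilter : (List ℕ → Bool) → List (List ℕ) → List (List ℕ)
bfilter p [] = []
bfilter p (π ∷ S) = if p π then π ∷ bfilter p S else bfilter p S

SnPlus : ℕ → List (List ℕ)
SnPlus n = bfilter isPlus (Sn n)

SnMinus : ℕ → List (List ℕ)
SnMinus n = bfilter isMinus (Sn n)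

genPoly : (List ℕ → ℕ) → List (List ℕ) → ℕ → ℕ
genPoly stat S x = sum (map (λ π → x ^ stat π) S)

T : ℕ → ℕ → ℕ
T n = genPoly udrun (Sn n)

Wbar : ℕ → ℕ → ℕ
Wbar n = genPoly lpk (Sn n)

TE : ℕ → ℕ → ℕ
TE n = genPoly lpk (SnPlus n)

TO : ℕ → ℕ → ℕ
TO n = genPoly lpk (SnMinus n)

open import Relation.Binary.PropositionalEquality using (_≡_; refl)
private
  c1 : length (Sn 4) ≡ 24
  c1 = refl
  c2 : T 3 2 ≡ 30
  c2 = refl
  c3 : T 4 3 ≡ TE 4 9 + 3 * TO 4 9
  c3 = refl
  c4 : Wbar 4 3 ≡ TE 4 3 + TO 4 3
  c4 = refl

-- Reading 0 π(1) ⋯ π(n) left to right, every direction change is a peak or a valley, and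
-- peaks and valleys alternate.  The word starts with an ascent, so it has 2·lpk π alternating
-- runs if it ends with a descent and 2·lpk π + 1 if it ends with an ascent; hence
-- udrun π = 2·lpk π + [π ∈ S_n⁻], which splits T_n by the last step.  The second identity is
-- the same split of S_n into S_n⁺ and S_n⁻.
module Submission where

open import Defs
open import Algebra.Properties.CommutativeSemigroup using (x∙yz≈y∙xz; xy∙z≈xz∙y; xy∙z≈x∙zy)
open import Data.Bool using (Bool; true; false; not; _∧_; if_then_else_)
open import Data.List using (List; []; _∷_; length)
open import Data.List.Relation.Unary.All as All using (All; []; _∷_)
open import Data.List.Relation.Unary.All.Properties using (++⁺; map⁺; concat⁺; all-filter; filter⁺)
open import Data.List.Relation.Unary.AllPairs using (_∷_)
open import Data.List.Relation.Unary.Linked using (Linked; [-]; _∷_)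
open import Data.List.Relation.Unary.Linked.Properties using (AllPairs⇒Linked)
open import Data.Nat using (ℕ; zero; suc; _+_; _*_; _^_; _<_; _<?_; _≥_; z<s)
open import Data.Nat.Properties
  using ( _≟_; <-cmp; <⇒≢; +-comm; +-assoc; +-identityʳ; *-zeroʳ; *-identityʳ; *-distribˡ-+; ^-*-assoc
        ; +-commutativeSemigroup)
open import Data.List.Relation.Unary.Unique.DecPropositional _≟_ using (Unique; unique?)
open import Data.Product using (_×_; _,_; uncurry)
open import Relation.Binary.Definitions using (tri<; tri≈; tri>)
open import Relation.Binary.PropositionalEquality using (_≡_; _≢_; refl; sym; trans; cong; cong₂; module ≡-Reasoning)
open import Relation.Nullary using (¬_; contradiction)
open import Relation.Nullary.Decidable using (dec-true; dec-false; isYes≗does)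

open ≡-Reasoning

iverson : Bool → ℕ
iverson true = 1
iverson false = 0

-- isMinus is definitionally isPlus ᶜ.
_ᶜ : (List ℕ → Bool) → List ℕ → Bool
(p ᶜ) π = if p π then false else true

lt-true : ∀ {a b} → a < b → lt a b ≡ true
lt-true {a} {b} a<b = trans (isYes≗does (a <? b)) (dec-true (a <? b) a<b)

lt-false : ∀ {a b} → ¬ a < b → lt a b ≡ false
lt-false {a} {b} a≮b = trans (isYes≗does (a <? b)) (dec-false (a <? b) a≮b)

lt-flip : ∀ {a b} → a ≢ b → lt b a ≡ not (lt a b)
lt-flip {a} {b} a≢b with <-cmp a b
... | tri< a<b _ b≮a = trans (lt-false b≮a) (cong not (sym (lt-true a<b)))
... | tri≈ _ a≡b _ = contradiction a≡b a≢b
... | tri> a≮b _ b<a = trans (lt-true b<a) (cong not (sym (lt-false a≮b)))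

turnAt peakAt : ℕ → ℕ → ℕ → ℕ
turnAt a b c = if (lt a b ∧ lt c b) then 1 else if (lt b a ∧ lt b c) then 1 else 0
peakAt a b c = if (lt a b ∧ lt c b) then 1 else 0

turnAt+ascent : ∀ {a b c} → a ≢ b → b ≢ c →
  turnAt a b c + iverson (lt a b) ≡ 2 * peakAt a b c + iverson (lt b c)
turnAt+ascent {a} {b} {c} a≢b b≢c rewrite lt-flip a≢b | lt-flip b≢c with lt a b | lt b c
... | true  | true  = refl
... | true  | false = refl
... | false | true  = refl
... | false | false = refl

turns+ascent≡2*peaks+ascent : ∀ {a b rest} → Linked _≢_ (a ∷ b ∷ rest) →
  turns (a ∷ b ∷ rest) + iverson (lt a b)
    ≡ 2 * peaks (a ∷ b ∷ rest) + iverson (not (lastDesc (a ∷ b ∷ rest)))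
turns+ascent≡2*peaks+ascent {a} {b} {[]} (a≢b ∷ [-]) rewrite lt-flip a≢b with lt a b
... | true  = refl
... | false = refl
turns+ascent≡2*peaks+ascent {a} {b} {c ∷ rest} (a≢b ∷ bc@(b≢c ∷ _)) = begin
  turnAt a b c + τ + iverson (lt a b)       ≡⟨ xy∙z≈xz∙y +-commutativeSemigroup (turnAt a b c) τ _ ⟩
  turnAt a b c + iverson (lt a b) + τ       ≡⟨ cong (_+ τ) (turnAt+ascent a≢b b≢c) ⟩
  2 * peakAt a b c + iverson (lt b c) + τ   ≡⟨ xy∙z≈x∙zy +-commutativeSemigroup (2 * peakAt a b c) _ τ ⟩
  2 * peakAt a b c + (τ + iverson (lt b c)) ≡⟨ cong (2 * peakAt a b c +_) (turns+ascent≡2*peaks+ascent bc) ⟩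
  2 * peakAt a b c + (2 * ρ + e)            ≡⟨ sym (+-assoc (2 * peakAt a b c) (2 * ρ) e) ⟩
  2 * peakAt a b c + 2 * ρ + e              ≡⟨ cong (_+ e) (sym (*-distribˡ-+ 2 (peakAt a b c) ρ)) ⟩
  2 * (peakAt a b c + ρ) + e                ∎
  where
  τ ρ e : ℕ
  τ = turns (b ∷ c ∷ rest)
  ρ = peaks (b ∷ c ∷ rest)
  e = iverson (not (lastDesc (b ∷ c ∷ rest)))

udrun≡2*lpk+ascent : ∀ {π} → π ≢ [] → Unique (0 ∷ π) →
  udrun π ≡ 2 * lpk π + iverson (not (isPlus π))
udrun≡2*lpk+ascent {[]} π≢[] _ = contradiction refl π≢[]
udrun≡2*lpk+ascent {zero ∷ _} _ ((0≢0 ∷ _) ∷ _) = contradiction refl 0≢0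
udrun≡2*lpk+ascent {suc a ∷ rest} _ u =
  trans (+-comm 1 (turns (0 ∷ suc a ∷ rest))) (turns+ascent≡2*peaks+ascent (AllPairs⇒Linked u))

genPoly-split : ∀ p stat S x →
  genPoly stat S x ≡ genPoly stat (bfilter p S) x + genPoly stat (bfilter (p ᶜ) S) x
genPoly-split p stat [] x = refl
genPoly-split p stat (π ∷ S) x with p π
... | true  = trans (cong (x ^ stat π +_) (genPoly-split p stat S x)) (sym (+-assoc (x ^ stat π) A B))
  where
  A B : ℕ
  A = genPoly stat (bfilter p S) x
  B = genPoly stat (bfilter (p ᶜ) S) x
... | false = trans (cong (x ^ stat π +_) (genPoly-split p stat S x))
                    (x∙yz≈y∙xz +-commutativeSemigroup (x ^ stat π) A B)
  where
  A B : ℕ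
  A = genPoly stat (bfilter p S) x
  B = genPoly stat (bfilter (p ᶜ) S) x

^-double : ∀ x k → x ^ (2 * k) ≡ (x * x) ^ k
^-double x k = trans (sym (^-*-assoc x 2 k)) (cong (_^ k) (cong (x *_) (*-identityʳ x)))

genPoly-halve : ∀ p s t S x → All (λ π → s π ≡ 2 * t π + iverson (not (p π))) S →
  genPoly s S x ≡ genPoly t (bfilter p S) (x * x) + x * genPoly t (bfilter (p ᶜ) S) (x * x)
genPoly-halve p s t [] x [] = sym (*-zeroʳ x)
genPoly-halve p s t (π ∷ S) x (s≡2t+e ∷ eqs) with p π
... | true = begin
  x ^ s π + genPoly s S x                 ≡⟨ cong₂ _+_ x^s≡ (genPoly-halve p s t S x eqs) ⟩
  (x * x) ^ t π + (A + x * B)             ≡⟨ sym (+-assoc _ A (x * B)) ⟩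
  (x * x) ^ t π + A + x * B               ∎
  where
  A B : ℕ
  A = genPoly t (bfilter p S) (x * x)
  B = genPoly t (bfilter (p ᶜ) S) (x * x)
  x^s≡ : x ^ s π ≡ (x * x) ^ t π
  x^s≡ = trans (cong (x ^_) (trans s≡2t+e (+-identityʳ _))) (^-double x (t π))
... | false = begin
  x ^ s π + genPoly s S x                 ≡⟨ cong₂ _+_ x^s≡ (genPoly-halve p s t S x eqs) ⟩
  x * (x * x) ^ t π + (A + x * B)         ≡⟨ x∙yz≈y∙xz +-commutativeSemigroup _ A (x * B) ⟩
  A + (x * (x * x) ^ t π + x * B)         ≡⟨ cong (A +_) (sym (*-distribˡ-+ x _ B)) ⟩
  A + x * ((x * x) ^ t π + B)             ∎
  where
  A B : ℕ
  A = genPoly t (bfilter p S) (x * x)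
  B = genPoly t (bfilter (p ᶜ) S) (x * x)
  x^s≡ : x ^ s π ≡ x * (x * x) ^ t π
  x^s≡ = trans (cong (x ^_) (trans s≡2t+e (+-comm _ 1))) (cong (x *_) (^-double x (t π)))

range-positive : ∀ n → All (0 <_) (range n)
range-positive zero = []
range-positive (suc n) = ++⁺ (range-positive n) (z<s ∷ [])

words-letters : ∀ {P : ℕ → Set} n k → All P (range n) → All (All P) (words n k)
words-letters n zero _ = [] ∷ []
words-letters n (suc k) P-range =
  concat⁺ (map⁺ (All.map (λ Pa → map⁺ (All.map (Pa ∷_) (words-letters n k P-range))) P-range))

words-length : ∀ n k → All (λ w → length w ≡ k) (words n k)
words-length n zero = refl ∷ []
words-length n (suc k) =
  concat⁺ (map⁺ (All.universal (λ _ → map⁺ (All.map (cong suc) (words-length n k))) (range n)))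

length≡suc⇒≢[] : ∀ {π : List ℕ} {m} → length π ≡ suc m → π ≢ []
length≡suc⇒≢[] () refl

Sn-nonempty-unique-after-0 : ∀ m → All (λ π → π ≢ [] × Unique (0 ∷ π)) (Sn (suc m))
Sn-nonempty-unique-after-0 m = All.zipWith
  (λ { ((len , pos) , u) → length≡suc⇒≢[] len , (All.map <⇒≢ pos ∷ u) })
  ( filter⁺ unique? (All.zip (words-length n n , words-letters n n (range-positive n)))
  , all-filter unique? (words n n))
  where
  n : ℕ
  n = suc m

proposition2p9 : (n : ℕ) → n ≥ 1 → (x : ℕ) →
    (T n x ≡ TE n (x * x) + x * TO n (x * x)) × (Wbar n x ≡ TE n x + TO n x)
proposition2p9 (suc m) _ x =
  genPoly-halve isPlus udrun lpk (Sn (suc m)) x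
    (All.map (uncurry udrun≡2*lpk+ascent) (Sn-nonempty-unique-after-0 m)) ,
  genPoly-split isPlus lpk (Sn (suc m)) x
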